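{- Consider any execution of the Happy Swap Algorithm on a token swapping instance whose graph $G$ is a tree. For every swap performed, at least one of its two moves is inevitable.
   Context: A token swapping instance consists of a tree $G=(V,E)$ with $n$ vertices, a set $T$ of $n$ tokens, and bijections $v_0,v_f:T\to V$ (starting and destination vertices); at all times each vertex holds one token, $v(t)$ denotes the current vertex of $t$, and initially $v(t)=v_0(t)$. A swap of adjacent tokens $t_1,t_2$ (i.e. $(v(t_1),v(t_2))\in E$) exchanges their vertices; it consists of the two moves $t_1\to v(t_2)$ and $t_2\to v(t_1)$. $d$ denotes graph distance, $p(t)$ the unique path from $v_0(t)$ to $v_f(t)$, and $d(t)=d(v_0(t),v_f(t))$. A token $t$ is happy if $v(t)=v_f(t)$. A swap of $(t_1,t_2)$ is a happy swap if $d(v_f(t_1),v(t_2))=d(v_f(t_1),v(t_1))-1$ and $d(v_f(t_2),v(t_1))=d(v_f(t_2),v(t_2))-1$. It is a shove if one of the tokens, say $t_1$, is happy and $d(v_f(t_2),v(t_1))=d(v_f(t_2),v(t_2))-1$. The Happy Swap Algorithm repeatedly, while some token is not happy, performs an arbitrary available happy swap or shove. A move $t\to v$ is inevitable if it is among the first $d(t)$ moves of token $t$ during the execution, and redundant otherwise. -}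

module Defs where

open import Data.Nat using (ℕ; zero; suc; _+_; _<_; _≤_; _≥_)
open import Data.Fin using (Fin; _≟_)
open import Data.List using (List; []; _∷_; length; _++_)
open import Data.List.Relation.Unary.Linked using (Linked)
open import Data.List.Relation.Unary.Unique.Propositional using (Unique)
open import Data.Product using (Σ; ∃; _×_; _,_)
open import Data.Sum using (_⊎_)
open import Data.Empty using (⊥)
open import Relation.Nullary using (¬_; yes; no)
open import Relation.Binary.PropositionalEquality using (_≡_; _≢_)
open import Function.Definitions using (Bijective)

data Walk {n : ℕ} (E : Fin n → Fin n → Set) : Fin n → Fin n → ℕ → Set where
  here : ∀ {u} → Walk E u u 0
  step : ∀ {u w v k} → E u w → Walk E w v k → Walk E u v (suc k)

IsCycle : {n : ℕ} → (Fin n → Fin n → Set) → List (Fin n) → Set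
IsCycle E [] = ⊥
IsCycle E (x ∷ xs) =
  3 ≤ length (x ∷ xs) × Unique (x ∷ xs) × Linked E (x ∷ xs) × LastAdj xs
  where
  LastAdj : List _ → Set
  LastAdj [] = E x x
  LastAdj (y ∷ []) = E y x
  LastAdj (y ∷ z ∷ zs) = LastAdj (z ∷ zs)

record IsTree {n : ℕ} (E : Fin n → Fin n → Set) : Set where
  field
    symmetric   : ∀ {u v} → E u v → E v u
    irreflexive : ∀ {u} → ¬ E u u
    connected   : ∀ u v → ∃ λ k → Walk E u v k
    acyclic     : ∀ cs → ¬ IsCycle E cs

IsDistance : {n : ℕ} → (Fin n → Fin n → Set) → (Fin n → Fin n → ℕ) → Set
IsDistance E d = ∀ u v → Walk E u v (d u v) × (∀ m → Walk E u v m → d u v ≤ m)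

-- Token swapping. Tokens are Fin n; a configuration maps tokens to vertices.

Config : ℕ → Set
Config n = Fin n → Fin n

swap : {n : ℕ} → Config n → Fin n → Fin n → Config n
swap v t₁ t₂ t with t ≟ t₁
... | yes _ = v t₂
... | no _ with t ≟ t₂
...   | yes _ = v t₁
...   | no _ = v t

module TokenSwapping {n : ℕ} (E : Fin n → Fin n → Set) (d : Fin n → Fin n → ℕ)
                     (vf : Config n) where

  Happy : Config n → Fin n → Set
  Happy v t = v t ≡ vf t

  HappySwap : Config n → Fin n → Fin n → Set
  HappySwap v t₁ t₂ = suc (d (vf t₁) (v t₂)) ≡ d (vf t₁) (v t₁)
                    × suc (d (vf t₂) (v t₁)) ≡ d (vf t₂) (v t₂)

  ShoveBy : Config n → Fin n → Fin n → Set
  ShoveBy v t₁ t₂ = Happy v t₁ × suc (d (vf t₂) (v t₁)) ≡ d (vf t₂) (v t₂)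

  Shove : Config n → Fin n → Fin n → Set
  Shove v t₁ t₂ = ShoveBy v t₁ t₂ ⊎ ShoveBy v t₂ t₁

  ValidStep : Config n → Fin n → Fin n → Set
  ValidStep v t₁ t₂ = (∃ λ t → ¬ Happy v t)
                    × E (v t₁) (v t₂)
                    × (HappySwap v t₁ t₂ ⊎ Shove v t₁ t₂)

  data Run : Config n → List (Fin n × Fin n) → Set where
    done : ∀ {v} → Run v []
    next : ∀ {v t₁ t₂ ss} → ValidStep v t₁ t₂ → Run (swap v t₁ t₂) ss
         → Run v ((t₁ , t₂) ∷ ss)

movesOf : {n : ℕ} → Fin n → List (Fin n × Fin n) → ℕ
movesOf t [] = 0
movesOf t ((a , b) ∷ ss) = hit a + hit b + movesOf t ss
  where
  hit : Fin _ → ℕ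
  hit x with t ≟ x
  ... | yes _ = 1
  ... | no _ = 0

-- In an execution whose swaps before the current one are `pre`, the move of
-- token t in the current swap is its (movesOf t pre + 1)-th move; it is
-- inevitable iff this is among its first d(t) = d(v₀ t, v_f t) moves.
Inevitable : {n : ℕ} → (d : Fin n → Fin n → ℕ) → (v₀ vf : Config n)
           → List (Fin n × Fin n) → Fin n → Set
Inevitable d v₀ vf pre t = suc (movesOf t pre) ≤ d (v₀ t) (vf t)

{-# OPTIONS --safe #-}
module Submission where

-- A token is on track when the moves it has made plus its remaining distance equal d(t), i.e.
-- every move so far brought it closer to its destination; a move of an on-track token towards
-- its destination is therefore inevitable. A token leaves the track only by being shoved while
-- happy, so an off-track token always stays within distance 1 of its destination, and two
-- distinct off-track tokens never stand on each other's destinations. So a token that advances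
-- in a swap without making an inevitable move is off track and lands on its destination; in a
-- happy swap this would make the two tokens such a forbidden pair, and in a shove it would give
-- the advancing token the destination of the happy one.

open import Defs
open import Data.Nat using (ℕ; suc; _+_; _≤_; _<_; z<s)
open import Data.Nat.Properties using (+-suc; +-comm; ≤-antisym; <⇒≤; m<m+n; n<1⇒n≡0)
import Data.Nat as ℕ
open import Data.Fin using (Fin; _≟_)
open import Data.Fin.Permutation.Components using (transpose; transpose-inverse)
open import Data.List using (List; []; _∷_; _++_)
open import Data.List.Properties using (++-assoc; ++-identityʳ)
open import Data.Product using (_×_; _,_; proj₁; proj₂; ∃)
open import Data.Sum using (_⊎_; inj₁; inj₂)
open import Data.Empty using (⊥-elim)
open import Relation.Nullary using (¬_; yes; no)
open import Relation.Binary.PropositionalEquality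
open import Function using (id)
open import Function.Definitions using (Bijective; Injective)

module _ {n : ℕ} {E : Fin n → Fin n → Set} where

  walk-snoc : ∀ {u w v k} → Walk E u w k → E w v → Walk E u v (suc k)
  walk-snoc here       e = step e here
  walk-snoc (step e w) e′ = step e (walk-snoc w e′)

  walk-reverse : (∀ {u v} → E u v → E v u) → ∀ {u v k} → Walk E u v k → Walk E v u k
  walk-reverse _     here       = here
  walk-reverse sym-E (step e w) = walk-snoc (walk-reverse sym-E w) (sym-E e)

  walk₀⇒≡ : ∀ {u v} → Walk E u v 0 → u ≡ v
  walk₀⇒≡ here = refl

module _ {n : ℕ} {E : Fin n → Fin n → Set} {d : Fin n → Fin n → ℕ} (dist : IsDistance E d) where

  d≡0⇒≡ : ∀ {u v} → d u v ≡ 0 → u ≡ v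
  d≡0⇒≡ {u} {v} eq = walk₀⇒≡ (subst (Walk E u v) eq (proj₁ (dist u v)))

  adjacent⇒d≤1 : ∀ {u v} → E u v → d u v ≤ 1
  adjacent⇒d≤1 {u} {v} e = proj₂ (dist u v) 1 (step e here)

  d-sym : (∀ {u v} → E u v → E v u) → ∀ u v → d u v ≡ d v u
  d-sym sym-E u v = ≤-antisym (d-sym-≤ u v) (d-sym-≤ v u)
    where
    d-sym-≤ : ∀ u v → d u v ≤ d v u
    d-sym-≤ u v = proj₂ (dist u v) (d v u) (walk-reverse sym-E (proj₁ (dist v u)))

module _ {n : ℕ} (v : Config n) (a b : Fin n) where

  swap≗transpose : ∀ t → swap v a b t ≡ v (transpose a b t)
  swap≗transpose t with t ≟ a
  ... | yes _ = refl
  ... | no _ with t ≟ b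
  ...   | yes _ = refl
  ...   | no _  = refl

  swap-injective : Injective _≡_ _≡_ v → Injective _≡_ _≡_ (swap v a b)
  swap-injective v-inj {x} {y} eq = begin
    x                                ≡⟨ sym (transpose-inverse b a) ⟩
    transpose b a (transpose a b x)  ≡⟨ cong (transpose b a) (v-inj same-vertex) ⟩
    transpose b a (transpose a b y)  ≡⟨ transpose-inverse b a ⟩
    y                                ∎
    where
    open ≡-Reasoning
    same-vertex : v (transpose a b x) ≡ v (transpose a b y)
    same-vertex = trans (sym (swap≗transpose x)) (trans eq (swap≗transpose y))

  data SwapRole (t y : Fin n) (k : ℕ) : Set where
    first     : t ≡ a → y ≡ v b → k ≡ 1 → SwapRole t y k
    second    : t ≡ b → y ≡ v a → k ≡ 1 → SwapRole t y k
    bystander : y ≡ v t → k ≡ 0 → SwapRole t y k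

  swap-role : a ≢ b → ∀ t → SwapRole t (swap v a b t) (movesOf t ((a , b) ∷ []))
  swap-role a≢b t with t ≟ a
  ... | yes t≡a with t ≟ b
  ...   | yes t≡b = ⊥-elim (a≢b (trans (sym t≡a) t≡b))
  ...   | no _    = first t≡a refl refl
  swap-role a≢b t | no _ with t ≟ b
  ...   | yes t≡b = second t≡b refl refl
  ...   | no _    = bystander refl refl

movesOf-++ : ∀ {n} (t : Fin n) xs ys → movesOf t (xs ++ ys) ≡ movesOf t xs + movesOf t ys
movesOf-++ t []             ys = refl
movesOf-++ t ((a , b) ∷ xs) ys with t ≟ a | t ≟ b
... | yes _ | yes _ = cong (2 +_) (movesOf-++ t xs ys)
... | yes _ | no _  = cong suc (movesOf-++ t xs ys)
... | no _  | yes _ = cong suc (movesOf-++ t xs ys)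
... | no _  | no _  = movesOf-++ t xs ys

movesOf-snoc : ∀ {n} (t : Fin n) xs x {k} → movesOf t (x ∷ []) ≡ k
             → movesOf t (xs ++ x ∷ []) ≡ k + movesOf t xs
movesOf-snoc t xs x refl = trans (movesOf-++ t xs (x ∷ [])) (+-comm (movesOf t xs) _)

module HappySwapInvariant {n : ℕ} (E : Fin n → Fin n → Set) (tree : IsTree E)
  (d : Fin n → Fin n → ℕ) (dist : IsDistance E d)
  (v₀ vf : Config n) (vf-injective : Injective _≡_ _≡_ vf) where

  open TokenSwapping E d vf
  open IsTree tree using (symmetric; irreflexive)

  Swaps : Set
  Swaps = List (Fin n × Fin n)

  OnTrack : Config n → Swaps → Fin n → Set
  OnTrack v pre t = movesOf t pre + d (vf t) (v t) ≡ d (v₀ t) (vf t)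

  Advances : Config n → Fin n → Fin n → Set
  Advances v t y = suc (d (vf t) y) ≡ d (vf t) (v t)

  record Invariant (v : Config n) (pre : Swaps) : Set where
    field
      injective         : Injective _≡_ _≡_ v
      onTrack⊎near      : ∀ t → OnTrack v pre t ⊎ d (vf t) (v t) ≤ 1
      offTrack-exchange : ∀ {t t′} → ¬ OnTrack v pre t → ¬ OnTrack v pre t′
                        → v t ≡ vf t′ → v t′ ≡ vf t → t ≡ t′
  open Invariant

  initial-invariant : Injective _≡_ _≡_ v₀ → Invariant v₀ []
  initial-invariant v₀-injective = record
    { injective         = v₀-injective
    ; onTrack⊎near      = λ t → inj₁ (starts-onTrack t)
    ; offTrack-exchange = λ ¬on _ _ _ → ⊥-elim (¬on (starts-onTrack _))
    }
    where
    starts-onTrack : ∀ t → OnTrack v₀ [] t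
    starts-onTrack t = d-sym dist symmetric (vf t) (v₀ t)

  near-advance⇒arrives : ∀ {v t y} → d (vf t) (v t) ≤ 1 → Advances v t y → y ≡ vf t
  near-advance⇒arrives {v} near adv = sym (d≡0⇒≡ dist (n<1⇒n≡0 (subst (_≤ 1) (sym adv) near)))

  onTrack-advance⇒inevitable : ∀ {v pre t y} → OnTrack v pre t → Advances v t y
                             → Inevitable d v₀ vf pre t
  onTrack-advance⇒inevitable {pre = pre} {t} on adv =
    subst (suc (movesOf t pre) ≤_) on (m<m+n (movesOf t pre) (subst (0 <_) adv z<s))

  advance⇒inevitable⊎arrives : ∀ {v pre t y} → Invariant v pre → Advances v t y
                             → Inevitable d v₀ vf pre t ⊎ (¬ OnTrack v pre t × y ≡ vf t)
  advance⇒inevitable⊎arrives {v} {pre} {t} inv adv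
    with movesOf t pre + d (vf t) (v t) ℕ.≟ d (v₀ t) (vf t)
  ... | yes on = inj₁ (onTrack-advance⇒inevitable {v} {pre} on adv)
  ... | no ¬on with onTrack⊎near inv t
  ...   | inj₁ on   = ⊥-elim (¬on on)
  ...   | inj₂ near = inj₂ (¬on , near-advance⇒arrives {v} near adv)

  data Move (v : Config n) (s : Fin n) : Fin n → Fin n → Set where
    advance : ∀ {t y} → Advances v t y → Move v s t y
    shove   : ∀ {y} → Happy v s → E (v s) y → Move v s s y

  module Step (v v′ : Config n) (pre pre′ : Swaps) (s : Fin n) where

    data Movement (t : Fin n) : Set where
      stays : v′ t ≡ v t → movesOf t pre′ ≡ movesOf t pre → Movement t
      moves : movesOf t pre′ ≡ suc (movesOf t pre) → Move v s t (v′ t) → Movement t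

    stays-onTrack : ∀ {t} → v′ t ≡ v t → movesOf t pre′ ≡ movesOf t pre
                  → OnTrack v′ pre′ t ≡ OnTrack v pre t
    stays-onTrack {t} at same = cong₂ (λ m y → m + d (vf t) y ≡ d (v₀ t) (vf t)) same at

    advance-onTrack : ∀ {t} → movesOf t pre′ ≡ suc (movesOf t pre) → Advances v t (v′ t)
                    → OnTrack v pre t → OnTrack v′ pre′ t
    advance-onTrack {t} moved adv on = begin
      movesOf t pre′ + d (vf t) (v′ t)       ≡⟨ cong (_+ d (vf t) (v′ t)) moved ⟩
      suc (movesOf t pre + d (vf t) (v′ t))  ≡⟨ sym (+-suc (movesOf t pre) _) ⟩
      movesOf t pre + suc (d (vf t) (v′ t))  ≡⟨ cong (movesOf t pre +_) adv ⟩
      movesOf t pre + d (vf t) (v t)         ≡⟨ on ⟩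
      d (v₀ t) (vf t)                        ∎
      where open ≡-Reasoning

    movement-near : Invariant v pre → ∀ {t} → Movement t
                  → OnTrack v′ pre′ t ⊎ d (vf t) (v′ t) ≤ 1
    movement-near inv {t} (stays at same) with onTrack⊎near inv t
    ... | inj₁ on   = inj₁ (subst id (sym (stays-onTrack {t} at same)) on)
    ... | inj₂ near = inj₂ (subst (λ y → d (vf t) y ≤ 1) (sym at) near)
    movement-near inv {t} (moves moved (advance adv)) with onTrack⊎near inv t
    ... | inj₁ on   = inj₁ (advance-onTrack moved adv on)
    ... | inj₂ near = inj₂ (<⇒≤ (subst (_≤ 1) (sym adv) near))
    movement-near inv (moves _ (shove happy e)) =
      inj₂ (adjacent⇒d≤1 dist (subst (λ x → E x _) happy e))

    data OffTrackCause : Fin n → Set where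
      was-offTrack : ∀ {t} → v′ t ≡ v t → ¬ OnTrack v pre t → OffTrackCause t
      arrived      : ∀ {t} → v′ t ≡ vf t → OffTrackCause t
      shoved-off   : Happy v s → OffTrackCause s

    offTrack-cause : Invariant v pre → ∀ {t} → Movement t → ¬ OnTrack v′ pre′ t
                   → OffTrackCause t
    offTrack-cause inv {t} (stays at same) ¬on =
      was-offTrack at (λ on → ¬on (subst id (sym (stays-onTrack {t} at same)) on))
    offTrack-cause inv {t} (moves moved (advance adv)) ¬on with onTrack⊎near inv t
    ... | inj₁ on   = ⊥-elim (¬on (advance-onTrack moved adv on))
    ... | inj₂ near = arrived (near-advance⇒arrives {v} near adv)
    offTrack-cause inv (moves _ (shove happy _)) _ = shoved-off happy

    movement-preserves : Invariant v pre → Injective _≡_ _≡_ v′ → (∀ t → Movement t)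
                       → Invariant v′ pre′
    movement-preserves inv v′-injective movement = record
      { injective         = v′-injective
      ; onTrack⊎near      = λ t → movement-near inv (movement t)
      ; offTrack-exchange = λ ¬on ¬on′ → exchange (cause ¬on) (cause ¬on′)
      }
      where
      cause : ∀ {t} → ¬ OnTrack v′ pre′ t → OffTrackCause t
      cause {t} = offTrack-cause inv (movement t)

      exchange : ∀ {t t′} → OffTrackCause t → OffTrackCause t′
               → v′ t ≡ vf t′ → v′ t′ ≡ vf t → t ≡ t′
      exchange (arrived at) _ p _ = vf-injective (trans (sym at) p)
      exchange _ (arrived at′) _ q = vf-injective (trans (sym q) at′)
      exchange (shoved-off _) (shoved-off _) _ _ = refl
      exchange (shoved-off happy) (was-offTrack at′ _) _ q =
        sym (injective inv (trans (sym at′) (trans q (sym happy))))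
      exchange (was-offTrack at _) (shoved-off happy′) p _ =
        injective inv (trans (sym at) (trans p (sym happy′)))
      exchange (was-offTrack at ¬on) (was-offTrack at′ ¬on′) p q =
        offTrack-exchange inv ¬on ¬on′ (trans (sym at) p) (trans (sym at′) q)

  swap-movement : ∀ {v pre a b s} → a ≢ b → Move v s a (v b) → Move v s b (v a)
                → ∀ t → Step.Movement v (swap v a b) pre (pre ++ (a , b) ∷ []) s t
  swap-movement {v} {pre} {a} {b} {s} a≢b move-a move-b t with swap-role v a b a≢b t
  ... | first refl at once  = Step.moves (movesOf-snoc t pre _ once) (subst (Move v s t) (sym at) move-a)
  ... | second refl at once = Step.moves (movesOf-snoc t pre _ once) (subst (Move v s t) (sym at) move-b)
  ... | bystander at never  = Step.stays at (movesOf-snoc t pre _ never)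

  adjacent⇒≢ : ∀ {v : Config n} {a b} → E (v a) (v b) → a ≢ b
  adjacent⇒≢ e refl = irreflexive e

  validStep-moves : ∀ {v a b} → ValidStep v a b → ∃ λ s → Move v s a (v b) × Move v s b (v a)
  validStep-moves {a = a} (_ , _ , inj₁ (adv-a , adv-b))         = a , advance adv-a , advance adv-b
  validStep-moves {a = a} (_ , e , inj₂ (inj₁ (happy , adv-b))) = a , shove happy e , advance adv-b
  validStep-moves {b = b} (_ , e , inj₂ (inj₂ (happy , adv-a))) =
    b , advance adv-a , shove happy (symmetric e)

  validStep-preserves : ∀ {v pre a b} → Invariant v pre → ValidStep v a b
                      → Invariant (swap v a b) (pre ++ (a , b) ∷ [])
  validStep-preserves {v} {pre} {a} {b} inv valid@(_ , e , _) with validStep-moves valid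
  ... | s , move-a , move-b =
    Step.movement-preserves v (swap v a b) pre _ s inv (swap-injective v a b (injective inv))
      (swap-movement (adjacent⇒≢ e) move-a move-b)

  moves-inevitable : ∀ {v pre a b s} → Invariant v pre → a ≢ b
                   → Move v s a (v b) → Move v s b (v a)
                   → Inevitable d v₀ vf pre a ⊎ Inevitable d v₀ vf pre b
  moves-inevitable inv a≢b (advance adv-a) (advance adv-b)
    with advance⇒inevitable⊎arrives inv adv-a | advance⇒inevitable⊎arrives inv adv-b
  ... | inj₁ a-inevitable | _                 = inj₁ a-inevitable
  ... | inj₂ _            | inj₁ b-inevitable = inj₂ b-inevitable
  ... | inj₂ (¬on-a , b-at) | inj₂ (¬on-b , a-at) =
        ⊥-elim (a≢b (offTrack-exchange inv ¬on-a ¬on-b a-at b-at))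
  moves-inevitable inv a≢b (shove happy _) (advance adv-b)
    with advance⇒inevitable⊎arrives inv adv-b
  ... | inj₁ b-inevitable = inj₂ b-inevitable
  ... | inj₂ (_ , a-at)   = ⊥-elim (a≢b (vf-injective (trans (sym happy) a-at)))
  moves-inevitable inv a≢b (advance adv-a) (shove happy _)
    with advance⇒inevitable⊎arrives inv adv-a
  ... | inj₁ a-inevitable = inj₁ a-inevitable
  ... | inj₂ (_ , b-at)   = ⊥-elim (a≢b (vf-injective (trans (sym b-at) happy)))
  moves-inevitable inv a≢b (shove _ _) (shove _ _) = ⊥-elim (a≢b refl)

  validStep-inevitable : ∀ {v pre a b} → Invariant v pre → ValidStep v a b
                       → Inevitable d v₀ vf pre a ⊎ Inevitable d v₀ vf pre b
  validStep-inevitable inv valid@(_ , e , _) with validStep-moves valid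
  ... | s , move-a , move-b = moves-inevitable inv (adjacent⇒≢ e) move-a move-b

  run-invariant : ∀ {v pre} mid {rest} → Invariant v pre → Run v (mid ++ rest)
                → ∃ λ v′ → Invariant v′ (pre ++ mid) × Run v′ rest
  run-invariant {v} {pre} [] inv run = v , subst (Invariant v) (sym (++-identityʳ pre)) inv , run
  run-invariant {pre = pre} (_ ∷ mid) inv (next valid run) =
    subst (λ p → ∃ λ v′ → Invariant v′ p × Run v′ _) (++-assoc pre _ mid)
      (run-invariant mid (validStep-preserves inv valid) run)

  run-inevitable : Injective _≡_ _≡_ v₀ → ∀ pre {post t₁ t₂}
                 → Run v₀ (pre ++ (t₁ , t₂) ∷ post)
                 → Inevitable d v₀ vf pre t₁ ⊎ Inevitable d v₀ vf pre t₂
  run-inevitable v₀-injective pre run with run-invariant pre (initial-invariant v₀-injective) run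
  ... | _ , inv , next valid _ = validStep-inevitable inv valid

mainTheorem7 : (n : ℕ) (E : Fin n → Fin n → Set) → IsTree E
    → (d : Fin n → Fin n → ℕ) → IsDistance E d
    → (v₀ vf : Fin n → Fin n) → Bijective _≡_ _≡_ v₀ → Bijective _≡_ _≡_ vf
    → (ss : List (Fin n × Fin n)) → TokenSwapping.Run E d vf v₀ ss
    → (pre post : List (Fin n × Fin n)) (t₁ t₂ : Fin n)
    → ss ≡ pre ++ (t₁ , t₂) ∷ post
    → Inevitable d v₀ vf pre t₁ ⊎ Inevitable d v₀ vf pre t₂
mainTheorem7 _ E tree d dist v₀ vf (v₀-injective , _) (vf-injective , _) _ run pre _ _ _ refl =
  HappySwapInvariant.run-inevitable E tree d dist v₀ vf vf-injective v₀-injective pre run
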